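{- Let $G$ be a graph on $n$ vertices with maximum degree at most $K\delta$. Then there are $O(n\delta^{2k-1})$ paths $u_{ -k}u_{ -k+1}\dots u_k$ in $G$ with the following two properties: (i) $(u_{ -\ell},u_{\ell})$ is $(i,j)$-poor for every $1\leq \ell\leq k$ and every $0\leq i,j\leq k-1$; and (ii) there exist $1\leq \alpha,\beta\leq k$ with $\alpha+\beta> k$ such that there exist $(|V(H)|+2)(2k+1)+1$ pairwise internally vertex-disjoint paths of length $\alpha+\beta$ between $u_{ -\alpha}$ and $u_{\beta}$. The implied constant depends only on $k,|V(H)|,K$.
   Context: Fix an integer $k\geq 1$, a multigraph $F$, $H=F^{2k-1}$ (the graph obtained from $F$ by replacing its edges with pairwise internally vertex-disjoint paths of length $2k$), and positive reals $K,\delta$. For $x\in V(G)$ and an integer $i\ge 0$, $\mathcal{P}_i(x)$ is the set of directed paths of length $i$ starting at $x$, and for $P\in\mathcal{P}_i(x)$, $v(P)$ is its endpoint. For nonnegative integers $i,j$ with $i+j<2k$, a pair $(x,y)$ of distinct vertices is $(i,j)$-rich if the number of pairs $(P,Q)\in \mathcal{P}_i(x)\times \mathcal{P}_j(y)$ such that there are at least $(|V(H)|+2)(2k+1)+1$ pairwise internally vertex-disjoint paths of length $2k-i-j$ between $v(P)$ and $v(Q)$ is more than $(2(i+j)|V(H)|(2k+1)+2(i+1)j)(K\delta)^{i+j-1}$. Otherwise (including when $x=y$) the pair is $(i,j)$-poor.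
   Formalization: The parameters K and δ range over the positive rationals instead of the positive reals, and the implied constant is taken in ℚ. -}

module Defs where

open import Data.Nat as ℕ using (ℕ; zero; suc; _+_; _*_; _∸_)
open import Data.Integer using (+_)
open import Data.Rational as ℚ using (ℚ; 0ℚ; 1ℚ)
open import Data.Bool using (Bool; true; false)
open import Data.Fin using (Fin)
open import Data.Vec as Vec using (Vec; []; _∷_; toList)
open import Data.List as List using (List; []; _∷_; length; filterᵇ; allFin)
open import Data.List.Membership.Propositional using (_∈_; _∉_)
open import Data.List.Relation.Unary.All using (All)
open import Data.List.Relation.Unary.AllPairs using (AllPairs)
open import Data.List.Relation.Unary.Unique.Propositional using (Unique)
open import Data.Product using (Σ; ∃; _×_)
open import Data.Unit using (⊤)
open import Data.Empty using (⊥)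
open import Relation.Binary.PropositionalEquality using (_≡_; _≢_)

⟦_⟧ : ℕ → ℚ
⟦ m ⟧ = (+ m) ℚ./ 1

_^ℚ_ : ℚ → ℕ → ℚ
q ^ℚ zero  = 1ℚ
q ^ℚ suc m = q ℚ.* (q ^ℚ m)

record Multigraph : Set where
  field
    nV    : ℕ
    edges : List (Fin nV × Fin nV)

-- H = F^{2k-1}: every edge is replaced by a path of length 2k, which adds
-- 2k-1 new internal vertices per edge.
|V[F^_]| : ℕ → Multigraph → ℕ
|V[F^ k ]| F = Multigraph.nV F + length (Multigraph.edges F) * (2 * k ∸ 1)

record Graph (n : ℕ) : Set where
  field
    adj     : Fin n → Fin n → Bool
    adj-sym : ∀ x y → adj x y ≡ adj y x
    adj-irr : ∀ x → adj x x ≡ false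

module _ {n : ℕ} (G : Graph n) where
  open Graph G

  Adj : Fin n → Fin n → Set
  Adj x y = adj x y ≡ true

  degree : Fin n → ℕ
  degree x = length (filterᵇ (adj x) (allFin n))

  MaxDegreeAtMost : ℚ → Set
  MaxDegreeAtMost D = ∀ x → ⟦ degree x ⟧ ℚ.≤ D

  IsWalk : ∀ {m} → Vec (Fin n) m → Set
  IsWalk []           = ⊤
  IsWalk (a ∷ [])     = ⊤
  IsWalk (a ∷ b ∷ vs) = Adj a b × IsWalk (b ∷ vs)

  -- a path = a walk with pairwise distinct vertices; a vector of length
  -- L+1 encodes a path of length L (listed from its first vertex)
  IsPath : ∀ {m} → Vec (Fin n) m → Set
  IsPath vs = IsWalk vs × Unique (toList vs)

  In𝒫 : ∀ {i} → Vec (Fin n) (suc i) → ℕ → Fin n → Set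
  In𝒫 P i x = IsPath P × Vec.head P ≡ x

  PathBetween : (L : ℕ) → Fin n → Fin n → Vec (Fin n) (suc L) → Set
  PathBetween L a b P = IsPath P × Vec.head P ≡ a × Vec.last P ≡ b

dropLast : ∀ {A : Set} → List A → List A
dropLast []           = []
dropLast (x ∷ [])     = []
dropLast (x ∷ y ∷ xs) = x ∷ dropLast (y ∷ xs)

inner : ∀ {A : Set} → List A → List A
inner []       = []
inner (x ∷ xs) = dropLast xs

InternallyDisjoint : ∀ {n m} → Vec (Fin n) m → Vec (Fin n) m → Set
InternallyDisjoint P Q = ∀ z → z ∈ inner (toList P) → z ∉ inner (toList Q)

module _ {n : ℕ} (G : Graph n) where

  ManyDisjointPaths : (N L : ℕ) → Fin n → Fin n → Set
  ManyDisjointPaths N L a b =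
    Σ (List (Vec (Fin n) (suc L))) λ ps →
      All (PathBetween G L a b) ps ×
      AllPairs (λ P Q → P ≢ Q × InternallyDisjoint P Q) ps ×
      N ℕ.≤ length ps

  -- the richness threshold (2(i+j)|V(H)|(2k+1) + 2(i+1)j) (Kδ)^{i+j-1};
  -- when i+j = 0 the coefficient is 0, so the threshold is 0
  threshold : (k h : ℕ) (K δ : ℚ) (i j : ℕ) → ℚ
  threshold k h K δ zero zero = 0ℚ
  threshold k h K δ i j =
    ⟦ 2 * (i + j) * h * (2 * k + 1) + 2 * (i + 1) * j ⟧ ℚ.* ((K ℚ.* δ) ^ℚ (i + j ∸ 1))

  Rich : (k h : ℕ) (K δ : ℚ) (i j : ℕ) → Fin n → Fin n → Set
  Rich k h K δ i j x y =
    x ≢ y ×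
    Σ (List (Vec (Fin n) (suc i) × Vec (Fin n) (suc j))) λ pqs →
      Unique pqs ×
      All (λ pq → In𝒫 G (Data.Product.proj₁ pq) i x
                × In𝒫 G (Data.Product.proj₂ pq) j y
                × ManyDisjointPaths ((h + 2) * (2 * k + 1) + 1) (2 * k ∸ (i + j))
                     (Vec.last (Data.Product.proj₁ pq)) (Vec.last (Data.Product.proj₂ pq)))
          pqs ×
      threshold k h K δ i j ℚ.< ⟦ length pqs ⟧
    where import Data.Product

  Poor : (k h : ℕ) (K δ : ℚ) (i j : ℕ) → Fin n → Fin n → Set
  Poor k h K δ i j x y = Rich k h K δ i j x y → ⊥

-- Paths u_{-k} … u_k are vectors of length 2k+1; entry t is u_{t-k}.
-- ix v t reads entry t (clamped to the last entry if out of range, which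
-- never happens in the statement).

ix : ∀ {A : Set} {m} → Vec A (suc m) → ℕ → A
ix (a ∷ [])     _       = a
ix (a ∷ b ∷ vs) zero    = a
ix (a ∷ b ∷ vs) (suc t) = ix (b ∷ vs) t

module _ {n : ℕ} (G : Graph n) (k h : ℕ) (K δ : ℚ) where

  -- u_{-ℓ} = ix u (k ∸ ℓ),  u_ℓ = ix u (k + ℓ)
  GoodPath : Vec (Fin n) (suc (2 * k)) → Set
  GoodPath u =
    IsPath G u ×
    (∀ ℓ i j → 1 ℕ.≤ ℓ → ℓ ℕ.≤ k → i ℕ.< k → j ℕ.< k →
       Poor G k h K δ i j (ix u (k ∸ ℓ)) (ix u (k + ℓ))) ×
    (Σ ℕ λ α → Σ ℕ λ β →
       1 ℕ.≤ α × α ℕ.≤ k × 1 ℕ.≤ β × β ℕ.≤ k × k ℕ.< α + β ×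
       ManyDisjointPaths G ((h + 2) * (2 * k + 1) + 1) (α + β)
         (ix u (k ∸ α)) (ix u (k + β)))

{-# OPTIONS --safe #-}
module Submission where

-- Fix α and β and put ℓ = α + β − k, i = k − β, j = k − α, so that u₋α, u₋ℓ, u_ℓ, u_β sit at
-- positions j, j + i, j + i + 2ℓ and j + i + 2ℓ + j of the path u₋ₖ … uₖ.  Such a good path is
-- determined by: u₋ℓ (n choices); the walk u₋ℓ … u_ℓ from it ((Kδ)^{2ℓ} choices, as every vertex
-- has at most Kδ neighbours); the pair P = u₋ℓ … u₋α, Q = u_ℓ … u_β, which lies in 𝒫_i(u₋ℓ) × 𝒫_j(u_ℓ)
-- and has endpoints joined by many disjoint paths of length α + β = 2k − i − j, so that poorness of
-- (u₋ℓ, u_ℓ) leaves at most the richness threshold O((Kδ)^{i+j−1}) choices; and the walks u_β … uₖ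
-- and u₋α … u₋ₖ from now fixed vertices ((Kδ)^i and (Kδ)^j choices).  The product is
-- O(n (Kδ)^{2k−1}), and there are at most (k + 1)² choices of α and β.  Each of these steps is
-- an instance of counting by fibres: if g takes at most N values on S and f takes at most
-- c values on every fibre of g, then f takes at most N c values on S.

open import Defs

module Counting where

  open import Algebra.Bundles using (CommutativeRing)
  open import Data.Bool using (T?)
  open import Data.Bool.Properties using (T-≡)
  open import Data.Fin using (Fin)
  open import Data.Fin.Instances
  open import Data.Integer as ℤ using ()
  import Data.Integer.Properties as ℤP
  open import Data.List as List using (List; []; _∷_; length; filter; filterᵇ; allFin; deduplicate)
  import Data.List.Properties as ListP
  open import Data.List.Membership.Propositional using (_∈_)
  open import Data.List.Membership.Propositional.Properties
    using (∈-upTo⁺; ∈-filter⁺; ∈-allFin; ∈-∃++; ∈-++⁻; ∈-++⁺ˡ; ∈-++⁺ʳ)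
  open import Data.List.Relation.Unary.All as All using (All; []; _∷_)
  import Data.List.Relation.Unary.All.Properties as AllP
  open import Data.List.Relation.Unary.AllPairs using (AllPairs; []; _∷_)
  import Data.List.Relation.Unary.AllPairs.Properties as AllPairsP
  open import Data.List.Relation.Unary.Any as Any using (Any; here; there)
  import Data.List.Relation.Unary.Any.Properties as AnyP
  open import Data.List.Relation.Unary.Unique.DecSetoid.Properties using (deduplicate-!)
  open import Data.List.Relation.Unary.Unique.Propositional using (Unique)
  import Data.List.Relation.Unary.Unique.Propositional.Properties as UniqueP
  open import Data.Nat using (ℕ; zero; suc; _+_; _*_; _∸_; _≤_; _<_; z≤n; s≤s)
  open import Data.Nat.Coprimality as Coprime using (1-coprimeTo)
  open import Data.Nat.Instances
  import Data.Nat.Properties as ℕP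
  open import Data.Nat.Tactic.RingSolver using (solve-∀)
  open import Data.Product using (Σ; ∃-syntax; _×_; _,_; proj₁; proj₂; <_,_>)
  open import Data.Product.Instances
  open import Data.Product.Properties using (,-injectiveˡ; ,-injectiveʳ)
  open import Data.Rational as ℚ using (ℚ; 0ℚ; 1ℚ; mkℚ)
  import Data.Rational.Properties as ℚP
  open import Data.Rational.Solver using (module +-*-Solver)
  open import Data.Sum using (inj₁; inj₂)
  open import Data.Unit using (tt)
  open import Data.Vec as Vec using (Vec; []; _∷_; toList)
  open import Data.Vec.Instances
  import Data.Vec.Properties as VecP
  open import Function using (_∘_; _on_; id)
  open import Function.Bundles using (Equivalence)
  open import Relation.Binary.Bundles using (DecSetoid)
  import Relation.Binary.Construct.On as On
  open import Relation.Binary.PropositionalEquality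
  open import Relation.Binary.PropositionalEquality.Properties using () renaming (decSetoid to ≡-decSetoid)
  open import Relation.Binary.Structures using (IsDecEquivalence)
  open import Relation.Binary.TypeClasses using (_≟_)
  open import Relation.Nullary using (yes; no; contradiction)
  import Relation.Unary as Unary
  open import Relation.Unary.Properties using (∁?)

  open import Algebra.Properties.CommutativeSemiring.Exp
    (CommutativeRing.commutativeSemiring ℚP.+-*-commutativeRing) using (_^_; ^-homo-*; ^-distrib-*)

  private
    variable
      A B C : Set

  ⟦_⟧≡mkℚ : ∀ m → ⟦ m ⟧ ≡ mkℚ (ℤ.+ m) 0 (Coprime.sym (1-coprimeTo m))
  ⟦ m ⟧≡mkℚ = ℚP.normalize-coprime (Coprime.sym (1-coprimeTo m))

  ⟦⟧-+ : ∀ m p → ⟦ m + p ⟧ ≡ ⟦ m ⟧ ℚ.+ ⟦ p ⟧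
  ⟦⟧-+ m p rewrite ⟦ m ⟧≡mkℚ | ⟦ p ⟧≡mkℚ | ℤP.*-identityʳ (ℤ.+ m) | ℤP.*-identityʳ (ℤ.+ p) = refl

  ⟦⟧-mono : ∀ {m p} → m ≤ p → ⟦ m ⟧ ℚ.≤ ⟦ p ⟧
  ⟦⟧-mono {m} {p} m≤p rewrite ⟦ m ⟧≡mkℚ | ⟦ p ⟧≡mkℚ =
    ℚ.*≤* (subst₂ ℤ._≤_ (sym (ℤP.*-identityʳ (ℤ.+ m))) (sym (ℤP.*-identityʳ (ℤ.+ p))) (ℤ.+≤+ m≤p))

  ⟦⟧-nonNeg : ∀ m → 0ℚ ℚ.≤ ⟦ m ⟧
  ⟦⟧-nonNeg m = ⟦⟧-mono {0} {m} z≤n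

  *-nonNeg : ∀ {p q} → 0ℚ ℚ.≤ p → 0ℚ ℚ.≤ q → 0ℚ ℚ.≤ p ℚ.* q
  *-nonNeg {p} {q} p≥0 q≥0 = ℚP.nonNegative⁻¹ (p ℚ.* q)
    {{ℚP.nonNeg*nonNeg⇒nonNeg p {{ℚ.nonNegative p≥0}} q {{ℚ.nonNegative q≥0}}}}

  ^ℚ-nonNeg : ∀ {q} m → 0ℚ ℚ.≤ q → 0ℚ ℚ.≤ q ^ℚ m
  ^ℚ-nonNeg zero    q≥0 = ℚP.nonNegative⁻¹ 1ℚ
  ^ℚ-nonNeg (suc m) q≥0 = *-nonNeg q≥0 (^ℚ-nonNeg m q≥0)

  ^ℚ≗^ : ∀ q m → q ^ℚ m ≡ q ^ m
  ^ℚ≗^ q zero    = refl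
  ^ℚ≗^ q (suc m) = cong (q ℚ.*_) (^ℚ≗^ q m)

  ^ℚ-+ : ∀ q m p → q ^ℚ (m + p) ≡ q ^ℚ m ℚ.* q ^ℚ p
  ^ℚ-+ q m p rewrite ^ℚ≗^ q (m + p) | ^ℚ≗^ q m | ^ℚ≗^ q p = ^-homo-* q m p

  ^ℚ-distrib-* : ∀ p q m → (p ℚ.* q) ^ℚ m ≡ p ^ℚ m ℚ.* q ^ℚ m
  ^ℚ-distrib-* p q m rewrite ^ℚ≗^ (p ℚ.* q) m | ^ℚ≗^ p m | ^ℚ≗^ q m = ^-distrib-* p q m

  unique⊆⇒length≤ : ∀ (xs ys : List A) → AllPairs _≢_ xs → All (_∈ ys) xs → length xs ≤ length ys
  unique⊆⇒length≤ []       ys _            _              = z≤n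
  unique⊆⇒length≤ (x ∷ xs) ys (x∉xs ∷ xs!) (x∈ys ∷ xs⊆ys) with ∈-∃++ x∈ys
  ... | zs , ws , refl = begin
    suc (length xs)                  ≤⟨ s≤s (unique⊆⇒length≤ xs (zs List.++ ws) xs! xs⊆zs++ws) ⟩
    suc (length (zs List.++ ws))     ≡⟨ cong suc (ListP.length-++ zs) ⟩
    suc (length zs + length ws)      ≡⟨ ℕP.+-suc (length zs) (length ws) ⟨
    length zs + length (x ∷ ws)      ≡⟨ ListP.length-++ zs ⟨
    length (zs List.++ x ∷ ws)       ∎
    where
    open ℕP.≤-Reasoning
    drop-x : ∀ {y} → y ∈ zs List.++ x ∷ ws → x ≢ y → y ∈ zs List.++ ws
    drop-x y∈ x≢y with ∈-++⁻ zs y∈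
    ... | inj₁ y∈zs         = ∈-++⁺ˡ y∈zs
    ... | inj₂ (here y≡x)   = contradiction (sym y≡x) x≢y
    ... | inj₂ (there y∈ws) = ∈-++⁺ʳ zs y∈ws
    xs⊆zs++ws = All.zipWith (λ (y∈ , x≢y) → drop-x y∈ x≢y) (xs⊆ys , x∉xs)

  length-filter+∁ : ∀ {P : A → Set} (P? : Unary.Decidable P) xs →
                    length xs ≡ length (filter P? xs) + length (filter (∁? P?) xs)
  length-filter+∁ P? []       = refl
  length-filter+∁ P? (x ∷ xs) with P? x
  ... | yes _ = cong suc (length-filter+∁ P? xs)
  ... | no  _ = trans (cong suc (length-filter+∁ P? xs)) (sym (ℕP.+-suc _ _))

  map-proj₁-toList : ∀ {P : A → Set} {xs} (pxs : All P xs) → List.map proj₁ (All.toList pxs) ≡ xs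
  map-proj₁-toList []         = refl
  map-proj₁-toList (px ∷ pxs) = cong (_ ∷_) (map-proj₁-toList pxs)

  -- #[ f ∣ S ]≤ q : f takes at most q distinct values on S.
  infix 4 #[_∣_]≤_
  #[_∣_]≤_ : (A → B) → (A → Set) → ℚ → Set
  #[ f ∣ S ]≤ q = ∀ xs → All S xs → AllPairs (_≢_ on f) xs → ⟦ length xs ⟧ ℚ.≤ q

  Fibre : (A → Set) → (A → B) → A → A → Set
  Fibre S g a x = S x × g x ≡ g a

  module _ {A A′ B B′ : Set} {S : A → Set} {S′ : A′ → Set} {f : A → B} {f′ : A′ → B′} {q : ℚ} where

    #-transfer : (h : A → A′) → (∀ {a} → S a → S′ (h a)) →
                 (∀ {a b} → S a → S b → f′ (h a) ≡ f′ (h b) → f a ≡ f b) →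
                 #[ f′ ∣ S′ ]≤ q → #[ f ∣ S ]≤ q
    #-transfer h S⇒S′ reflects #f′ xs Sxs xs! =
      subst (λ m → ⟦ m ⟧ ℚ.≤ q) (ListP.length-map h xs)
        (#f′ (List.map h xs) (AllP.map⁺ (All.map S⇒S′ Sxs)) (AllPairsP.map⁺ (distinct Sxs xs!)))
      where
      distinct : ∀ {xs} → All S xs → AllPairs (_≢_ on f) xs → AllPairs (_≢_ on (f′ ∘ h)) xs
      distinct []         []         = []
      distinct (Sx ∷ Sxs) (x≢ ∷ xs!) =
        All.zipWith (λ (fx≢fy , Sy) eq → fx≢fy (reflects Sx Sy eq)) (x≢ , Sxs) ∷ distinct Sxs xs!

  #-map : ∀ {A′ : Set} {S : A → Set} {S′ : A′ → Set} {q} (h : A → A′) →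
          (∀ {a} → S a → S′ (h a)) → #[ id ∣ S′ ]≤ q → #[ h ∣ S ]≤ q
  #-map h S⇒S′ = #-transfer h S⇒S′ (λ _ _ eq → eq)

  #-weaken : ∀ {f : A → B} {S q q′} → q ℚ.≤ q′ → #[ f ∣ S ]≤ q → #[ f ∣ S ]≤ q′
  #-weaken q≤q′ #f xs Sxs xs! = ℚP.≤-trans (#f xs Sxs xs!) q≤q′

  #-listed : ∀ {f : A → B} {S} (L : List B) → (∀ {a} → S a → f a ∈ L) → #[ f ∣ S ]≤ ⟦ length L ⟧
  #-listed {f = f} L f∈L xs Sxs xs! = ⟦⟧-mono (subst (_≤ length L) (ListP.length-map f xs)
    (unique⊆⇒length≤ (List.map f xs) L (AllPairsP.map⁺ xs!) (AllP.map⁺ (All.map f∈L Sxs))))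

  #-bounded : ∀ {S : A → Set} {m} (f : A → ℕ) → (∀ {a} → S a → f a ≤ m) → #[ f ∣ S ]≤ ⟦ suc m ⟧
  #-bounded {m = m} f f≤m = #-weaken (ℚP.≤-reflexive (cong ⟦_⟧ (ListP.length-upTo (suc m))))
    (#-listed (List.upTo (suc m)) (λ Sa → ∈-upTo⁺ (s≤s (f≤m Sa))))

  #-Fin : ∀ {n} {S : A → Set} (f : A → Fin n) → #[ f ∣ S ]≤ ⟦ n ⟧
  #-Fin {n = n} f = #-weaken (ℚP.≤-reflexive (cong ⟦_⟧ (ListP.length-tabulate {n = n} id)))
    (#-listed (allFin n) (λ {a} _ → ∈-allFin (f a)))

  module _ {S : A → Set} {f : A → C} (g : A → B) {{_ : IsDecEquivalence {A = B} _≡_}} {c : ℚ} where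

    private
      #-covered : (∀ {a} → S a → #[ f ∣ Fibre S g a ]≤ c) →
                  ∀ reps → All S reps → ∀ xs → All S xs → AllPairs (_≢_ on f) xs →
                  All (λ x → Any (λ r → g r ≡ g x) reps) xs → ⟦ length xs ⟧ ℚ.≤ ⟦ length reps ⟧ ℚ.* c
      #-covered _      []         _            []  _   _    []      = ℚP.≤-reflexive (sym (ℚP.*-zeroˡ c))
      #-covered #fibre (r ∷ reps) (Sr ∷ Sreps) xs Sxs xs! covered = begin
        ⟦ length xs ⟧                               ≡⟨ cong ⟦_⟧ (length-filter+∁ (λ x → g x ≟ g r) xs) ⟩
        ⟦ length inFibre + length outside ⟧         ≡⟨ ⟦⟧-+ (length inFibre) (length outside) ⟩
        ⟦ length inFibre ⟧ ℚ.+ ⟦ length outside ⟧   ≤⟨ ℚP.+-mono-≤ #inFibre #outside ⟩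
        c ℚ.+ ⟦ length reps ⟧ ℚ.* c                 ≡⟨ cong (ℚ._+ ⟦ length reps ⟧ ℚ.* c) (ℚP.*-identityˡ c) ⟨
        1ℚ ℚ.* c ℚ.+ ⟦ length reps ⟧ ℚ.* c          ≡⟨ ℚP.*-distribʳ-+ c 1ℚ ⟦ length reps ⟧ ⟨
        (1ℚ ℚ.+ ⟦ length reps ⟧) ℚ.* c              ≡⟨ cong (ℚ._* c) (⟦⟧-+ 1 (length reps)) ⟨
        ⟦ suc (length reps) ⟧ ℚ.* c                 ∎
        where
        open ℚP.≤-Reasoning
        inFibre  = filter (λ x → g x ≟ g r) xs
        outside  = filter (∁? (λ x → g x ≟ g r)) xs
        #inFibre : ⟦ length inFibre ⟧ ℚ.≤ c
        #inFibre = #fibre Sr inFibre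
          (All.zipWith id (AllP.filter⁺ _ Sxs , AllP.all-filter _ xs)) (AllPairsP.filter⁺ _ xs!)
        #outside : ⟦ length outside ⟧ ℚ.≤ ⟦ length reps ⟧ ℚ.* c
        #outside = #-covered #fibre reps Sreps outside (AllP.filter⁺ _ Sxs) (AllPairsP.filter⁺ _ xs!)
          (All.zipWith (λ { (here gr≡gx , gx≢gr) → contradiction (sym gr≡gx) gx≢gr ; (there p , _) → p })
            (AllP.filter⁺ _ covered , AllP.all-filter _ xs))

    #-fibres : ∀ {N} → 0ℚ ℚ.≤ c → #[ g ∣ S ]≤ N → (∀ {a} → S a → #[ f ∣ Fibre S g a ]≤ c) →
               #[ f ∣ S ]≤ N ℚ.* c
    #-fibres c≥0 #g #fibre xs Sxs xs! = ℚP.≤-trans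
        (#-covered #fibre reps Sreps xs Sxs xs! covered)
        (ℚP.*-monoʳ-≤-nonNeg c {{ℚ.nonNegative c≥0}} (#g reps Sreps (deduplicate-! sameFibre xs)))
      where
      sameFibre = On.decSetoid (≡-decSetoid _≟_) g
      reps = deduplicate (DecSetoid._≟_ sameFibre) xs
      Sreps = AllP.deduplicate⁺ _ Sxs
      covered : All (λ x → Any (λ r → g r ≡ g x) reps) xs
      covered = All.tabulate λ x∈xs →
        AnyP.deduplicate⁺ _ trans (Any.map (λ x≡y → cong g (sym x≡y)) x∈xs)

  #-pair : ∀ {S : A → Set} {g : A → B} {φ : A → C} {N c} {{_ : IsDecEquivalence {A = B} _≡_}} →
           0ℚ ℚ.≤ c → #[ g ∣ S ]≤ N → (∀ {a} → S a → #[ φ ∣ Fibre S g a ]≤ c) →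
           #[ < g , φ > ∣ S ]≤ N ℚ.* c
  #-pair {g = g} c≥0 #g #φ = #-fibres g c≥0 #g λ Sa → #-transfer id id
    (λ (_ , gx≡ga) (_ , gy≡ga) φx≡φy → cong₂ _,_ (trans gx≡ga (sym gy≡ga)) φx≡φy) (#φ Sa)

  tabulateℕ : (ℕ → A) → (m : ℕ) → Vec A m
  tabulateℕ f zero    = []
  tabulateℕ f (suc m) = f 0 ∷ tabulateℕ (f ∘ suc) m

  toList-tabulateℕ : ∀ (f : ℕ → A) m → toList (tabulateℕ f m) ≡ List.applyUpTo f m
  toList-tabulateℕ f zero    = refl
  toList-tabulateℕ f (suc m) = cong (f 0 ∷_) (toList-tabulateℕ (f ∘ suc) m)

  last-tabulateℕ : ∀ (f : ℕ → A) m → Vec.last (tabulateℕ f (suc m)) ≡ f m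
  last-tabulateℕ f zero    = refl
  last-tabulateℕ f (suc m) = last-tabulateℕ (f ∘ suc) m

  tabulateℕ-injective : ∀ (f g : ℕ → A) {m c} → tabulateℕ f m ≡ tabulateℕ g m → c < m → f c ≡ g c
  tabulateℕ-injective f g {suc m} {zero}  eq _         = VecP.∷-injectiveˡ eq
  tabulateℕ-injective f g {suc m} {suc c} eq (s≤s c<m) =
    tabulateℕ-injective (f ∘ suc) (g ∘ suc) (VecP.∷-injectiveʳ eq) c<m

  ix-∈ : ∀ {M} (u : Vec A (suc M)) {t} → t ≤ M → ix u t ∈ toList u
  ix-∈ (x ∷ [])     _                 = here refl
  ix-∈ (x ∷ y ∷ vs) {zero}  _         = here refl
  ix-∈ (x ∷ y ∷ vs) {suc t} (s≤s t≤M) = there (ix-∈ (y ∷ vs) t≤M)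

  ix-injective : ∀ {M} (u : Vec A (suc M)) → Unique (toList u) →
                 ∀ {s t} → s ≤ M → t ≤ M → ix u s ≡ ix u t → s ≡ t
  ix-injective (x ∷ [])     _         {zero}  {zero}  _         _         _  = refl
  ix-injective (x ∷ y ∷ vs) _         {zero}  {zero}  _         _         _  = refl
  ix-injective (x ∷ y ∷ vs) (x∉ ∷ _)  {zero}  {suc t} _         (s≤s t≤M) eq =
    contradiction eq (All.lookup x∉ (ix-∈ (y ∷ vs) t≤M))
  ix-injective (x ∷ y ∷ vs) (x∉ ∷ _)  {suc s} {zero}  (s≤s s≤M) _         eq =
    contradiction (sym eq) (All.lookup x∉ (ix-∈ (y ∷ vs) s≤M))
  ix-injective (x ∷ y ∷ vs) (_ ∷ vs!) {suc s} {suc t} (s≤s s≤M) (s≤s t≤M) eq =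
    cong suc (ix-injective (y ∷ vs) vs! s≤M t≤M eq)

  ix-extensional : ∀ {M} (u v : Vec A (suc M)) → (∀ {t} → t ≤ M → ix u t ≡ ix v t) → u ≡ v
  ix-extensional (x ∷ [])     (y ∷ [])     u≗v = cong (_∷ []) (u≗v z≤n)
  ix-extensional (x ∷ x′ ∷ u) (y ∷ y′ ∷ v) u≗v =
    cong₂ _∷_ (u≗v z≤n) (ix-extensional (x′ ∷ u) (y′ ∷ v) (u≗v ∘ s≤s))

  -- segment↑ u b m = (u_b, u_{b+1}, …, u_{b+m}) and segment↓ u b m = (u_b, u_{b−1}, …, u_{b−m}).
  -- Writing the indices as c + b keeps consecutive indices of segment↑ definitionally adjacent.
  segment↑ segment↓ : ∀ {M} → Vec A (suc M) → ℕ → (m : ℕ) → Vec A (suc m)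
  segment↑ u b m = tabulateℕ (λ c → ix u (c + b)) (suc m)
  segment↓ u b m = tabulateℕ (λ c → ix u (b ∸ c)) (suc m)

  last-segment↑ : ∀ {M} (u : Vec A (suc M)) b m → Vec.last (segment↑ u b m) ≡ ix u (m + b)
  last-segment↑ u b m = last-tabulateℕ (λ c → ix u (c + b)) m

  last-segment↓ : ∀ {M} (u : Vec A (suc M)) b m → Vec.last (segment↓ u b m) ≡ ix u (b ∸ m)
  last-segment↓ u b m = last-tabulateℕ (λ c → ix u (b ∸ c)) m

  segment↑-agree : ∀ {M} (u v : Vec A (suc M)) {b m t} →
                   segment↑ u b m ≡ segment↑ v b m → b ≤ t → t ≤ m + b → ix u t ≡ ix v t
  segment↑-agree u v {b} {m} {t} eq b≤t t≤m+b = subst (λ s → ix u s ≡ ix v s) (ℕP.m∸n+n≡m b≤t)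
    (tabulateℕ-injective (λ c → ix u (c + b)) (λ c → ix v (c + b)) eq
      (s≤s (ℕP.m≤n+o⇒m∸n≤o t b (subst (t ≤_) (ℕP.+-comm m b) t≤m+b))))

  segment↓-agree : ∀ {M} (u v : Vec A (suc M)) {b m t} →
                   segment↓ u b m ≡ segment↓ v b m → t ≤ b → b ≤ m + t → ix u t ≡ ix v t
  segment↓-agree u v {b} {m} {t} eq t≤b b≤m+t = subst (λ s → ix u s ≡ ix v s) (ℕP.m∸[m∸n]≡n t≤b)
    (tabulateℕ-injective (λ c → ix u (b ∸ c)) (λ c → ix v (b ∸ c)) eq
      (s≤s (ℕP.m≤n+o⇒m∸n≤o b t (subst (b ≤_) (ℕP.+-comm m t) b≤m+t))))

  module _ {n : ℕ} (G : Graph n) where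

    Adj-sym : ∀ {x y} → Adj G x y → Adj G y x
    Adj-sym {x} {y} xy = trans (Graph.adj-sym G y x) xy

    ix-adjacent : ∀ {M} (u : Vec (Fin n) (suc M)) → IsWalk G u →
                  ∀ {t} → suc t ≤ M → Adj G (ix u t) (ix u (suc t))
    ix-adjacent (x ∷ y ∷ [])     (xy , _) {zero}  _         = xy
    ix-adjacent (x ∷ y ∷ z ∷ vs) (xy , _) {zero}  _         = xy
    ix-adjacent (x ∷ y ∷ vs)     (_ , w)  {suc t} (s≤s t<M) = ix-adjacent (y ∷ vs) w t<M

    tabulateℕ-isWalk : ∀ (f : ℕ → Fin n) m → (∀ {c} → c < m → Adj G (f c) (f (suc c))) →
                       IsWalk G (tabulateℕ f (suc m))
    tabulateℕ-isWalk f zero    _   = tt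
    tabulateℕ-isWalk f (suc m) adj = adj (s≤s z≤n) , tabulateℕ-isWalk (f ∘ suc) m (adj ∘ s≤s)

    tabulateℕ-isPath : ∀ (f : ℕ → Fin n) m → (∀ {c} → c < m → Adj G (f c) (f (suc c))) →
                       (∀ {c d} → c ≤ m → d ≤ m → f c ≡ f d → c ≡ d) → IsPath G (tabulateℕ f (suc m))
    tabulateℕ-isPath f m adj inj = tabulateℕ-isWalk f m adj ,
      subst Unique (sym (toList-tabulateℕ f (suc m))) (UniqueP.applyUpTo⁺₁ f (suc m)
        (λ c<d d<1+m fc≡fd → let d≤m = ℕP.≤-pred d<1+m in
          ℕP.<⇒≢ c<d (inj (ℕP.<⇒≤ (ℕP.<-≤-trans c<d d≤m)) d≤m fc≡fd)))

    segment↑-isPath : ∀ {M} (u : Vec (Fin n) (suc M)) {b m} → IsPath G u → m + b ≤ M →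
                      IsPath G (segment↑ u b m)
    segment↑-isPath {M} u {b} {m} (u-walk , u!) m+b≤M = tabulateℕ-isPath _ m
      (λ c<m → ix-adjacent u u-walk (in-range c<m))
      (λ c≤m d≤m eq → ℕP.+-cancelʳ-≡ b _ _ (ix-injective u u! (in-range c≤m) (in-range d≤m) eq))
      where
      in-range : ∀ {c} → c ≤ m → c + b ≤ M
      in-range c≤m = ℕP.≤-trans (ℕP.+-monoˡ-≤ b c≤m) m+b≤M

    segment↓-isPath : ∀ {M} (u : Vec (Fin n) (suc M)) {b m} → IsPath G u → m ≤ b → b ≤ M →
                      IsPath G (segment↓ u b m)
    segment↓-isPath {M} u {b} {m} (u-walk , u!) m≤b b≤M = tabulateℕ-isPath _ m
      (λ {c} c<m → let b∸c≡1+b∸[1+c] = ℕP.+-∸-assoc 1 (ℕP.<-≤-trans c<m m≤b) in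
        subst (λ s → Adj G (ix u s) (ix u (b ∸ suc c))) (sym b∸c≡1+b∸[1+c])
          (Adj-sym (ix-adjacent u u-walk (subst (_≤ M) b∸c≡1+b∸[1+c] (in-range c)))))
      (λ {c} {d} c≤m d≤m eq → ℕP.∸-cancelˡ-≡ (ℕP.≤-trans c≤m m≤b) (ℕP.≤-trans d≤m m≤b)
        (ix-injective u u! (in-range c) (in-range d) eq))
      where
      in-range : ∀ c → b ∸ c ≤ M
      in-range c = ℕP.≤-trans (ℕP.m∸n≤m b c) b≤M

  module _ {n : ℕ} (G : Graph n) {E : ℚ} (E≥0 : 0ℚ ℚ.≤ E) (maxDeg : MaxDegreeAtMost G E) where

    WalkFrom : ∀ {m} → Fin n → Vec (Fin n) (suc m) → Set
    WalkFrom x P = IsWalk G P × Vec.head P ≡ x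

    #walksFrom : ∀ m x → #[ id ∣ WalkFrom {m} x ]≤ E ^ℚ m
    #walksFrom zero    x = #-listed ((x ∷ []) ∷ []) λ { {_ ∷ []} (_ , refl) → here refl }
    #walksFrom (suc m) x = #-fibres second (^ℚ-nonNeg m E≥0) #second λ {P} _ →
      #-transfer Vec.tail (λ { {_ ∷ _ ∷ _} (((_ , tail-walk) , _) , second≡) → tail-walk , second≡ })
        (λ { {_ ∷ _} {_ ∷ _} ((_ , refl) , _) ((_ , refl) , _) refl → refl })
        (#walksFrom m (second P))
      where
      second : Vec (Fin n) (suc (suc m)) → Fin n
      second P = Vec.head (Vec.tail P)
      #second : #[ second ∣ WalkFrom x ]≤ E
      #second = #-weaken (maxDeg x) (#-listed (filterᵇ (Graph.adj G x) (allFin n))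
        λ { {_ ∷ y ∷ _} ((xy , _) , refl) → ∈-filter⁺ (T? ∘ Graph.adj G x) (∈-allFin y) (Equivalence.from T-≡ xy) })

    #walk-extensions : ∀ {S : A → Set} {g : A → B} {m} (φ : A → Vec (Fin n) (suc m)) →
      (∀ {a} → S a → IsWalk G (φ a)) → (∀ {a b} → S a → S b → g a ≡ g b → Vec.head (φ a) ≡ Vec.head (φ b)) →
      ∀ {a} → S a → #[ φ ∣ Fibre S g a ]≤ E ^ℚ m
    #walk-extensions φ walk start {a} Sa =
      #-map φ (λ (Sx , gx≡ga) → walk Sx , start Sx Sa gx≡ga) (#walksFrom _ (Vec.head (φ a)))

  linkage : ℕ → ℕ → ℕ
  linkage k h = (h + 2) * (2 * k + 1) + 1

  coefficient : ℕ → ℕ → ℕ → ℕ → ℕ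
  coefficient k h i j = 2 * (i + j) * h * (2 * k + 1) + 2 * (i + 1) * j

  coefficient-mono : ∀ k h {i j i′ j′} → i ≤ i′ → j ≤ j′ → coefficient k h i j ≤ coefficient k h i′ j′
  coefficient-mono k h i≤i′ j≤j′ =
    ℕP.+-mono-≤ (ℕP.*-monoˡ-≤ (2 * k + 1) (ℕP.*-monoˡ-≤ h (ℕP.*-monoʳ-≤ 2 (ℕP.+-mono-≤ i≤i′ j≤j′))))
                (ℕP.*-mono-≤ (ℕP.*-monoʳ-≤ 2 (ℕP.+-monoˡ-≤ 1 i≤i′)) j≤j′)

  threshold-nonNeg : ∀ {n} (G : Graph n) k h {K δ} → 0ℚ ℚ.≤ K ℚ.* δ → ∀ i j → 0ℚ ℚ.≤ threshold G k h K δ i j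
  threshold-nonNeg G k h Kδ≥0 zero    zero    = ℚP.≤-refl
  threshold-nonNeg G k h Kδ≥0 zero    (suc j) =
    *-nonNeg (⟦⟧-nonNeg (coefficient k h 0 (suc j))) (^ℚ-nonNeg j Kδ≥0)
  threshold-nonNeg G k h Kδ≥0 (suc i) j       =
    *-nonNeg (⟦⟧-nonNeg (coefficient k h (suc i) j)) (^ℚ-nonNeg (i + j) Kδ≥0)

  module _ {n : ℕ} (G : Graph n) (k h : ℕ) (K δ : ℚ) where

    RichWitness : ∀ i j → Fin n → Fin n → Vec (Fin n) (suc i) × Vec (Fin n) (suc j) → Set
    RichWitness i j x y PQ = In𝒫 G (proj₁ PQ) i x × In𝒫 G (proj₂ PQ) j y ×
      ManyDisjointPaths G (linkage k h) (2 * k ∸ (i + j)) (Vec.last (proj₁ PQ)) (Vec.last (proj₂ PQ))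

    poor⇒#richWitnesses≤threshold : ∀ {i j x y} → x ≢ y → Poor G k h K δ i j x y →
                                    #[ id ∣ RichWitness i j x y ]≤ threshold G k h K δ i j
    poor⇒#richWitnesses≤threshold x≢y poor PQs witnesses PQs! =
      ℚP.≮⇒≥ λ threshold<#PQs → poor (x≢y , PQs , PQs! , witnesses , threshold<#PQs)

    -- x = u_{i+a} and y = u_{L+i+a} form an (i,j)-poor pair, although the ends u_a and u_{j+L+i+a} of
    -- P = u_{i+a} … u_a ∈ 𝒫_i(x) and Q = u_{L+i+a} … u_{j+L+i+a} ∈ 𝒫_j(y) are joined by many disjoint
    -- paths.  A good path with parameters α, β has this form for a = j = k − α, i = k − β, L = 2(α + β − k).
    PoorButLinked : ∀ {M} (a i L j : ℕ) → Vec (Fin n) (suc M) → Set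
    PoorButLinked a i L j u =
      IsPath G u ×
      Poor G k h K δ i j (ix u (i + a)) (ix u (L + (i + a))) ×
      ManyDisjointPaths G (linkage k h) (2 * k ∸ (i + j)) (ix u a) (ix u (j + (L + (i + a))))

  module _ {n : ℕ} (G : Graph n) (k h : ℕ) (K δ : ℚ)
           (Kδ≥0 : 0ℚ ℚ.≤ K ℚ.* δ) (maxDeg : MaxDegreeAtMost G (K ℚ.* δ))
           (a i L j r : ℕ) {M : ℕ} (L≥1 : 1 ≤ L) (M≡ : r + (j + (L + (i + a))) ≡ M) where

    private
      E = K ℚ.* δ
      S = PoorButLinked G k h K δ {M} a i L j
      Seq = Vec (Fin n) (suc M)

      px py pQ : ℕ
      px = i + a
      py = L + px
      pQ = j + py

      pQ≤M : pQ ≤ M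
      pQ≤M = subst (pQ ≤_) M≡ (ℕP.m≤n+m pQ r)
      py≤M : py ≤ M
      py≤M = ℕP.≤-trans (ℕP.m≤n+m py j) pQ≤M
      px≤M : px ≤ M
      px≤M = ℕP.≤-trans (ℕP.m≤n+m px L) py≤M
      a≤M : a ≤ M
      a≤M = ℕP.≤-trans (ℕP.m≤n+m a i) px≤M

      mid : Seq → Vec (Fin n) (suc L)
      mid u = segment↑ u px L
      P : Seq → Vec (Fin n) (suc i)
      P u = segment↓ u px i
      Q : Seq → Vec (Fin n) (suc j)
      Q u = segment↑ u py j
      right : Seq → Vec (Fin n) (suc r)
      right u = segment↑ u pQ r
      left : Seq → Vec (Fin n) (suc a)
      left u = segment↓ u a a

      View₂ View₃ View₄ View₅ : Set
      View₂ = Fin n × Vec (Fin n) (suc L)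
      View₃ = View₂ × Vec (Fin n) (suc i) × Vec (Fin n) (suc j)
      View₄ = View₃ × Vec (Fin n) (suc r)
      View₅ = View₄ × Vec (Fin n) (suc a)

      view₁ : Seq → Fin n
      view₁ u = ix u px
      view₂ : Seq → View₂
      view₂ = < view₁ , mid >
      view₃ : Seq → View₃
      view₃ = < view₂ , < P , Q > >
      view₄ : Seq → View₄
      view₄ = < view₃ , right >
      view₅ : Seq → View₅
      view₅ = < view₄ , left >

      #mid : ∀ {u₀} → S u₀ → #[ mid ∣ Fibre S view₁ u₀ ]≤ E ^ℚ L
      #mid = #walk-extensions G Kδ≥0 maxDeg mid
        (λ Su → proj₁ (segment↑-isPath G _ (proj₁ Su) py≤M)) (λ _ _ eq → eq)

      #PQ : ∀ {u₀} → S u₀ → #[ < P , Q > ∣ Fibre S view₂ u₀ ]≤ threshold G k h K δ i j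
      #PQ {u₀} (u₀-path , poor , _) =
        #-map < P , Q > witness (poor⇒#richWitnesses≤threshold G k h K δ x≢y poor)
        where
        x≢y : ix u₀ px ≢ ix u₀ py
        x≢y eq = ℕP.<⇒≢ (ℕP.m<n+m px L≥1) (ix-injective u₀ (proj₂ u₀-path) px≤M py≤M eq)
        witness : ∀ {u} → Fibre S view₂ u₀ u → RichWitness G k h K δ i j (ix u₀ px) (ix u₀ py) (P u , Q u)
        witness {u} ((u-path , _ , linked) , view₂≡) =
          (segment↓-isPath G u u-path (ℕP.m≤m+n i a) px≤M , ,-injectiveˡ view₂≡) ,
          (segment↑-isPath G u u-path pQ≤M ,
           segment↑-agree u u₀ (,-injectiveʳ view₂≡) (ℕP.m≤n+m px L) ℕP.≤-refl) ,
          subst₂ (ManyDisjointPaths G (linkage k h) (2 * k ∸ (i + j)))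
            (sym (trans (last-segment↓ u px i) (cong (ix u) (ℕP.m+n∸m≡n i a))))
            (sym (last-segment↑ u py j)) linked

      #right : ∀ {u₀} → S u₀ → #[ right ∣ Fibre S view₃ u₀ ]≤ E ^ℚ r
      #right = #walk-extensions G Kδ≥0 maxDeg right
        (λ Su → proj₁ (segment↑-isPath G _ (proj₁ Su) (ℕP.≤-reflexive M≡)))
        (λ {u} {v} _ _ eq → segment↑-agree u v (,-injectiveʳ (,-injectiveʳ eq)) (ℕP.m≤n+m py j) ℕP.≤-refl)

      #left : ∀ {u₀} → S u₀ → #[ left ∣ Fibre S view₄ u₀ ]≤ E ^ℚ a
      #left = #walk-extensions G Kδ≥0 maxDeg left
        (λ Su → proj₁ (segment↓-isPath G _ (proj₁ Su) ℕP.≤-refl a≤M))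
        (λ {u} {v} _ _ eq →
          segment↓-agree u v (,-injectiveˡ (,-injectiveʳ (,-injectiveˡ eq))) (ℕP.m≤n+m a i) ℕP.≤-refl)

      view₅-injective : ∀ {u v} → view₅ u ≡ view₅ v → u ≡ v
      view₅-injective {u} {v} eq = ix-extensional u v agree
        where
        eq₄ = ,-injectiveˡ eq
        eq₃ = ,-injectiveˡ eq₄
        agree : ∀ {t} → t ≤ M → ix u t ≡ ix v t
        agree {t} t≤M with t ℕP.≤? a | t ℕP.≤? px | t ℕP.≤? py | t ℕP.≤? pQ
        ... | yes t≤a | _ | _ | _ =
          segment↓-agree u v (,-injectiveʳ eq) t≤a (ℕP.m≤m+n a t)
        ... | no t≰a | yes t≤px | _ | _ =
          segment↓-agree u v (,-injectiveˡ (,-injectiveʳ eq₃)) t≤px (ℕP.+-monoʳ-≤ i (ℕP.<⇒≤ (ℕP.≰⇒> t≰a)))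
        ... | _ | no t≰px | yes t≤py | _ =
          segment↑-agree u v (,-injectiveʳ (,-injectiveˡ eq₃)) (ℕP.<⇒≤ (ℕP.≰⇒> t≰px)) t≤py
        ... | _ | _ | no t≰py | yes t≤pQ =
          segment↑-agree u v (,-injectiveʳ (,-injectiveʳ eq₃)) (ℕP.<⇒≤ (ℕP.≰⇒> t≰py)) t≤pQ
        ... | _ | _ | _ | no t≰pQ =
          segment↑-agree u v (,-injectiveʳ eq₄) (ℕP.<⇒≤ (ℕP.≰⇒> t≰pQ)) (subst (t ≤_) (sym M≡) t≤M)

    #PoorButLinked : #[ id ∣ PoorButLinked G k h K δ a i L j ]≤
                     ⟦ n ⟧ ℚ.* E ^ℚ L ℚ.* threshold G k h K δ i j ℚ.* E ^ℚ r ℚ.* E ^ℚ a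
    #PoorButLinked = #-transfer id id (λ _ _ → view₅-injective)
      (#-pair (^ℚ-nonNeg a Kδ≥0) (#-pair (^ℚ-nonNeg r Kδ≥0) (#-pair (threshold-nonNeg G k h Kδ≥0 i j)
        (#-pair (^ℚ-nonNeg L Kδ≥0) (#-Fin view₁) #mid) #PQ) #right) #left)

  decompose : ∀ {k α β} → α ≤ k → β ≤ k → k < α + β →
              ∃[ ℓ ] ∃[ i ] ∃[ j ] (1 ≤ ℓ × α ≡ ℓ + i × β ≡ ℓ + j × k ≡ ℓ + i + j)
  decompose {k} {α} {β} α≤k β≤k k<α+β =
    ℓ , i , j , ℕP.m<n⇒0<n∸m k<α+β , α≡ℓ+i , β≡ℓ+j , trans (sym α+j≡k) (cong (_+ j) α≡ℓ+i)
    where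
    open ≡-Reasoning
    ℓ = α + β ∸ k
    i = k ∸ β
    j = k ∸ α
    α+j≡k : α + j ≡ k
    α+j≡k = ℕP.m+[n∸m]≡n α≤k
    β+i≡k : β + i ≡ k
    β+i≡k = ℕP.m+[n∸m]≡n β≤k
    k+ℓ≡α+β : k + ℓ ≡ α + β
    k+ℓ≡α+β = ℕP.m+[n∸m]≡n (ℕP.<⇒≤ k<α+β)
    α≡ℓ+i : α ≡ ℓ + i
    α≡ℓ+i = ℕP.+-cancelˡ-≡ β α (ℓ + i) (begin
      β + α       ≡⟨ ℕP.+-comm β α ⟩
      α + β       ≡⟨ k+ℓ≡α+β ⟨
      k + ℓ       ≡⟨ cong (_+ ℓ) β+i≡k ⟨
      β + i + ℓ   ≡⟨ ℕP.+-assoc β i ℓ ⟩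
      β + (i + ℓ) ≡⟨ cong (β +_) (ℕP.+-comm i ℓ) ⟩
      β + (ℓ + i) ∎)
    β≡ℓ+j : β ≡ ℓ + j
    β≡ℓ+j = ℕP.+-cancelˡ-≡ α β (ℓ + j) (begin
      α + β       ≡⟨ k+ℓ≡α+β ⟨
      k + ℓ       ≡⟨ cong (_+ ℓ) α+j≡k ⟨
      α + j + ℓ   ≡⟨ ℕP.+-assoc α j ℓ ⟩
      α + (j + ℓ) ≡⟨ cong (α +_) (ℕP.+-comm j ℓ) ⟩
      α + (ℓ + j) ∎)

  goodPathConstant : ℕ → ℕ → ℚ → ℚ
  goodPathConstant k h K = ⟦ suc k ⟧ ℚ.* ⟦ suc k ⟧ ℚ.* (⟦ coefficient k h k k ⟧ ℚ.* K ^ℚ (2 * k ∸ 1))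

  module _ {n : ℕ} (G : Graph n) (h : ℕ) {K δ : ℚ} (K≥0 : 0ℚ ℚ.≤ K) (δ≥0 : 0ℚ ℚ.≤ δ)
           (maxDeg : MaxDegreeAtMost G (K ℚ.* δ)) where

    private
      E = K ℚ.* δ
      E≥0 = *-nonNeg K≥0 δ≥0

    perShapeBound : ℕ → ℚ
    perShapeBound k = ⟦ coefficient k h k k ⟧ ℚ.* K ^ℚ (2 * k ∸ 1) ℚ.* ⟦ n ⟧ ℚ.* δ ^ℚ (2 * k ∸ 1)

    perShapeBound-nonNeg : ∀ k → 0ℚ ℚ.≤ perShapeBound k
    perShapeBound-nonNeg k = *-nonNeg (*-nonNeg (*-nonNeg (⟦⟧-nonNeg (coefficient k h k k))
      (^ℚ-nonNeg (2 * k ∸ 1) K≥0)) (⟦⟧-nonNeg n)) (^ℚ-nonNeg (2 * k ∸ 1) δ≥0)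

    private
      product≤perShapeBound : ∀ ℓ i j s {T} → 2 * (ℓ + i + j) ≡ suc (ℓ + ℓ + s + i + j) →
        T ℚ.≤ ⟦ coefficient (ℓ + i + j) h (ℓ + i + j) (ℓ + i + j) ⟧ ℚ.* E ^ℚ s →
        ⟦ n ⟧ ℚ.* E ^ℚ (ℓ + ℓ) ℚ.* T ℚ.* E ^ℚ i ℚ.* E ^ℚ j ℚ.≤ perShapeBound (ℓ + i + j)
      product≤perShapeBound ℓ i j s {T} 2k≡1+e T≤ = begin
        ⟦ n ⟧ ℚ.* E ^ℚ (ℓ + ℓ) ℚ.* T ℚ.* E ^ℚ i ℚ.* E ^ℚ j
          ≤⟨ ℚP.*-monoʳ-≤-nonNeg (E ^ℚ j) {{ℚ.nonNegative (^ℚ-nonNeg j E≥0)}}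
               (ℚP.*-monoʳ-≤-nonNeg (E ^ℚ i) {{ℚ.nonNegative (^ℚ-nonNeg i E≥0)}}
                 (ℚP.*-monoˡ-≤-nonNeg (⟦ n ⟧ ℚ.* E ^ℚ (ℓ + ℓ))
                   {{ℚ.nonNegative (*-nonNeg (⟦⟧-nonNeg n) (^ℚ-nonNeg (ℓ + ℓ) E≥0))}} T≤)) ⟩
        ⟦ n ⟧ ℚ.* E ^ℚ (ℓ + ℓ) ℚ.* (c ℚ.* E ^ℚ s) ℚ.* E ^ℚ i ℚ.* E ^ℚ j
          ≡⟨ regroup ⟦ n ⟧ (E ^ℚ (ℓ + ℓ)) c (E ^ℚ s) (E ^ℚ i) (E ^ℚ j) ⟩
        c ℚ.* ⟦ n ⟧ ℚ.* (E ^ℚ (ℓ + ℓ) ℚ.* E ^ℚ s ℚ.* E ^ℚ i ℚ.* E ^ℚ j)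
          ≡⟨ cong (c ℚ.* ⟦ n ⟧ ℚ.*_) collect ⟩
        c ℚ.* ⟦ n ⟧ ℚ.* E ^ℚ e
          ≡⟨ cong (c ℚ.* ⟦ n ⟧ ℚ.*_) (^ℚ-distrib-* K δ e) ⟩
        c ℚ.* ⟦ n ⟧ ℚ.* (K ^ℚ e ℚ.* δ ^ℚ e)
          ≡⟨ swap c ⟦ n ⟧ (K ^ℚ e) (δ ^ℚ e) ⟩
        c ℚ.* K ^ℚ e ℚ.* ⟦ n ⟧ ℚ.* δ ^ℚ e
          ≡⟨ cong (λ m → c ℚ.* K ^ℚ m ℚ.* ⟦ n ⟧ ℚ.* δ ^ℚ m) (cong (_∸ 1) 2k≡1+e) ⟨
        perShapeBound (ℓ + i + j) ∎
        where
        open ℚP.≤-Reasoning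
        open +-*-Solver using (solve; _:*_; _:=_)
        c = ⟦ coefficient (ℓ + i + j) h (ℓ + i + j) (ℓ + i + j) ⟧
        e = ℓ + ℓ + s + i + j
        regroup : ∀ x y z w u v → x ℚ.* y ℚ.* (z ℚ.* w) ℚ.* u ℚ.* v ≡ z ℚ.* x ℚ.* (y ℚ.* w ℚ.* u ℚ.* v)
        regroup = solve 6 (λ x y z w u v → x :* y :* (z :* w) :* u :* v := z :* x :* (y :* w :* u :* v)) refl
        swap : ∀ x y z w → x ℚ.* y ℚ.* (z ℚ.* w) ≡ x ℚ.* z ℚ.* y ℚ.* w
        swap = solve 4 (λ x y z w → x :* y :* (z :* w) := x :* z :* y :* w) refl
        collect : E ^ℚ (ℓ + ℓ) ℚ.* E ^ℚ s ℚ.* E ^ℚ i ℚ.* E ^ℚ j ≡ E ^ℚ e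
        collect = sym (begin-equality
          E ^ℚ e                                         ≡⟨ ^ℚ-+ E (ℓ + ℓ + s + i) j ⟩
          E ^ℚ (ℓ + ℓ + s + i) ℚ.* E ^ℚ j                ≡⟨ cong (ℚ._* E ^ℚ j) (^ℚ-+ E (ℓ + ℓ + s) i) ⟩
          E ^ℚ (ℓ + ℓ + s) ℚ.* E ^ℚ i ℚ.* E ^ℚ j         ≡⟨ cong (λ x → x ℚ.* E ^ℚ i ℚ.* E ^ℚ j) (^ℚ-+ E (ℓ + ℓ) s) ⟩
          E ^ℚ (ℓ + ℓ) ℚ.* E ^ℚ s ℚ.* E ^ℚ i ℚ.* E ^ℚ j  ∎)

    shape-bound : ∀ ℓ i j →
      ⟦ n ⟧ ℚ.* E ^ℚ (ℓ + ℓ) ℚ.* threshold G (ℓ + i + j) h K δ i j ℚ.* E ^ℚ i ℚ.* E ^ℚ j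
        ℚ.≤ perShapeBound (ℓ + i + j)
    shape-bound ℓ zero zero = ℚP.≤-trans
      (ℚP.≤-reflexive (cong (λ x → x ℚ.* 1ℚ ℚ.* 1ℚ) (ℚP.*-zeroʳ (⟦ n ⟧ ℚ.* E ^ℚ (ℓ + ℓ)))))
      (perShapeBound-nonNeg (ℓ + 0 + 0))
    shape-bound ℓ zero (suc j) = product≤perShapeBound ℓ 0 (suc j) j (exponent ℓ j)
      (ℚP.*-monoʳ-≤-nonNeg (E ^ℚ j) {{ℚ.nonNegative (^ℚ-nonNeg j E≥0)}}
        (⟦⟧-mono (coefficient-mono k h {i′ = k} {j′ = k} z≤n (ℕP.m≤n+m (suc j) (ℓ + 0)))))
      where
      k = ℓ + 0 + suc j
      exponent : ∀ ℓ j → 2 * (ℓ + 0 + suc j) ≡ suc (ℓ + ℓ + j + 0 + suc j)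
      exponent = solve-∀
    shape-bound ℓ (suc i) j = product≤perShapeBound ℓ (suc i) j (i + j) (exponent ℓ i j)
      (ℚP.*-monoʳ-≤-nonNeg (E ^ℚ (i + j)) {{ℚ.nonNegative (^ℚ-nonNeg (i + j) E≥0)}}
        (⟦⟧-mono (coefficient-mono k h {i′ = k} {j′ = k}
          (ℕP.≤-trans (ℕP.m≤n+m (suc i) ℓ) (ℕP.m≤m+n (ℓ + suc i) j)) (ℕP.m≤n+m j (ℓ + suc i)))))
      where
      k = ℓ + suc i + j
      exponent : ∀ ℓ i j → 2 * (ℓ + suc i + j) ≡ suc (ℓ + ℓ + (i + j) + suc i + j)
      exponent = solve-∀

    Good : ℕ → Set
    Good k = Σ (Vec (Fin n) (suc (2 * k))) (GoodPath G k h K δ)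

    α-of β-of : ∀ {k} → Good k → ℕ
    α-of (_ , _ , _ , α , _) = α
    β-of (_ , _ , _ , _ , β , _) = β

    #good-of-shape : ∀ {k} ℓ i j → 1 ≤ ℓ → k ≡ ℓ + i + j →
      #[ proj₁ ∣ (λ (g : Good k) → (α-of g , β-of g) ≡ (ℓ + i , ℓ + j)) ]≤ perShapeBound k
    #good-of-shape {k} ℓ i j ℓ≥1 refl =
      #-map proj₁ (λ {g} → poorButLinked {g}) (#-weaken (shape-bound ℓ i j)
        (#PoorButLinked G k h K δ E≥0 maxDeg j i (ℓ + ℓ) j i (ℕP.≤-trans ℓ≥1 (ℕP.m≤m+n ℓ ℓ)) (length≡ ℓ i j)))
      where
      length≡ : ∀ ℓ i j → i + (j + (ℓ + ℓ + (i + j))) ≡ 2 * (ℓ + i + j)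
      length≡ = solve-∀
      k∸ℓ≡ : ℓ + i + j ∸ ℓ ≡ i + j
      k∸ℓ≡ = trans (cong (_∸ ℓ) (ℕP.+-assoc ℓ i j)) (ℕP.m+n∸m≡n ℓ (i + j))
      k+ℓ≡ : ∀ ℓ i j → ℓ + i + j + ℓ ≡ ℓ + ℓ + (i + j)
      k+ℓ≡ = solve-∀
      k+β≡ : ∀ ℓ i j → ℓ + i + j + (ℓ + j) ≡ j + (ℓ + ℓ + (i + j))
      k+β≡ = solve-∀
      2k≡ : ∀ ℓ i j → 2 * (ℓ + i + j) ≡ ℓ + i + (ℓ + j) + (i + j)
      2k≡ = solve-∀
      α+β≡ : ℓ + i + (ℓ + j) ≡ 2 * (ℓ + i + j) ∸ (i + j)
      α+β≡ = sym (trans (cong (_∸ (i + j)) (2k≡ ℓ i j)) (ℕP.m+n∸n≡m (ℓ + i + (ℓ + j)) (i + j)))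
      poorButLinked : ∀ {g : Good k} → (α-of g , β-of g) ≡ (ℓ + i , ℓ + j) →
                      PoorButLinked G k h K δ j i (ℓ + ℓ) j (proj₁ g)
      poorButLinked {u , path , poor , _ , _ , _ , _ , _ , _ , _ , linked} refl =
        path ,
        subst₂ (Poor G k h K δ i j) (cong (ix u) k∸ℓ≡) (cong (ix u) (k+ℓ≡ ℓ i j))
          (poor ℓ i j ℓ≥1 (ℕP.≤-trans (ℕP.m≤m+n ℓ i) (ℕP.m≤m+n (ℓ + i) j))
            (ℕP.≤-trans (ℕP.m<n+m i ℓ≥1) (ℕP.m≤m+n (ℓ + i) j))
            (ℕP.m<n+m j (ℕP.≤-trans ℓ≥1 (ℕP.m≤m+n ℓ i)))) ,
        subst₂ (λ m t → ManyDisjointPaths G (linkage k h) m (ix u j) (ix u t)) α+β≡ (k+β≡ ℓ i j)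
          (subst (λ t → ManyDisjointPaths G (linkage k h) (ℓ + i + (ℓ + j)) (ix u t) (ix u (k + (ℓ + j))))
            (ℕP.m+n∸m≡n (ℓ + i) j) linked)

    #good-with-αβ : ∀ k (g₀ : Good k) → #[ proj₁ ∣ Fibre Unary.U < α-of , β-of > g₀ ]≤ perShapeBound k
    #good-with-αβ k (_ , _ , _ , α , β , _ , α≤k , _ , β≤k , k<α+β , _) =
      let ℓ , i , j , ℓ≥1 , α≡ , β≡ , k≡ = decompose α≤k β≤k k<α+β in
      #-transfer id (λ (_ , αβ≡) → trans αβ≡ (cong₂ _,_ α≡ β≡)) (λ _ _ eq → eq) (#good-of-shape ℓ i j ℓ≥1 k≡)

    #good : ∀ k → #[ proj₁ ∣ Unary.U {A = Good k} ]≤ ⟦ suc k ⟧ ℚ.* ⟦ suc k ⟧ ℚ.* perShapeBound k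
    #good k = #-fibres < α-of , β-of > (perShapeBound-nonNeg k)
      (#-pair (⟦⟧-nonNeg (suc k))
        (#-bounded α-of λ { {_ , _ , _ , _ , _ , _ , α≤k , _} _ → α≤k })
        (λ _ → #-bounded β-of λ { {_ , _ , _ , _ , _ , _ , _ , _ , β≤k , _} _ → β≤k }))
      (λ {g₀} _ → #good-with-αβ k g₀)

    #goodPaths≤ : ∀ k (us : List (Vec (Fin n) (suc (2 * k)))) → Unique us → All (GoodPath G k h K δ) us →
                  ⟦ length us ⟧ ℚ.≤ goodPathConstant k h K ℚ.* ⟦ n ⟧ ℚ.* δ ^ℚ (2 * k ∸ 1)
    #goodPaths≤ k us us! good = begin
      ⟦ length us ⟧                                     ≡⟨ cong ⟦_⟧ length-toList ⟨
      ⟦ length (All.toList good) ⟧                      ≤⟨ #good k (All.toList good) (All.universal-U (All.toList good)) distinct ⟩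
      ⟦ suc k ⟧ ℚ.* ⟦ suc k ⟧ ℚ.* perShapeBound k       ≡⟨ reassociate ⟩
      goodPathConstant k h K ℚ.* ⟦ n ⟧ ℚ.* δ ^ℚ (2 * k ∸ 1) ∎
      where
      open ℚP.≤-Reasoning
      length-toList : length (All.toList good) ≡ length us
      length-toList = trans (sym (ListP.length-map proj₁ (All.toList good))) (cong length (map-proj₁-toList good))
      distinct : AllPairs (_≢_ on proj₁) (All.toList good)
      distinct = AllPairsP.map⁻ (subst Unique (sym (map-proj₁-toList good)) us!)
      s = ⟦ suc k ⟧ ℚ.* ⟦ suc k ⟧
      c = ⟦ coefficient k h k k ⟧ ℚ.* K ^ℚ (2 * k ∸ 1)
      reassociate : s ℚ.* perShapeBound k ≡ s ℚ.* c ℚ.* ⟦ n ⟧ ℚ.* δ ^ℚ (2 * k ∸ 1)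
      reassociate = trans (sym (ℚP.*-assoc s (c ℚ.* ⟦ n ⟧) (δ ^ℚ (2 * k ∸ 1))))
        (cong (ℚ._* δ ^ℚ (2 * k ∸ 1)) (sym (ℚP.*-assoc s c ⟦ n ⟧)))

open import Data.Nat using (ℕ; suc; _*_; _∸_)
open import Data.Rational using (ℚ; 0ℚ; _<_; _≤_)
import Data.Nat
open import Data.Fin using (Fin)
open import Data.Vec using (Vec)
open import Data.List using (List; length)
open import Data.List.Relation.Unary.All using (All)
open import Data.List.Relation.Unary.Unique.Propositional using (Unique)
open import Data.Product using (Σ; _,_)
open import Relation.Binary.PropositionalEquality using (_≡_)
open import Data.Rational.Properties using (<⇒≤)
open Counting using (goodPathConstant; #goodPaths≤)

lemma4p9 : (k : ℕ) → 1 Data.Nat.≤ k → (h : ℕ) → (K : ℚ) → 0ℚ < K →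
    Σ ℚ λ C →
      (F : Multigraph) → |V[F^ k ]| F ≡ h →
      (δ : ℚ) → 0ℚ < δ →
      (n : ℕ) (G : Graph n) → MaxDegreeAtMost G (K Data.Rational.* δ) →
      (us : List (Vec (Fin n) (suc (2 * k)))) → Unique us →
      All (GoodPath G k h K δ) us →
      ⟦ length us ⟧ ≤ C Data.Rational.* ⟦ n ⟧ Data.Rational.* (δ ^ℚ (2 * k ∸ 1))
lemma4p9 k _ h K K>0 = goodPathConstant k h K , λ _ _ δ δ>0 n G maxDeg →
  #goodPaths≤ G h (<⇒≤ K>0) (<⇒≤ δ>0) maxDeg k
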